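{- Let $G_k(x;z)=\sum_{n\geq k}\mathrm{js}(n,n-k;z)x^n$. Then $G_k(x;z)=(-1)^{k+1}F_k(1/x,-z)$.
   Context: The Jacobi-Stirling numbers of the first kind $\mathrm{js}(n,k;z)$ and of the second kind $\mathrm{JS}(n,k;z)$ ($n\geq k\geq 0$) are defined by $\mathrm{js}(n,k;z)=\mathrm{js}(n-1,k-1;z)+(n-1)(n-1+z)\mathrm{js}(n-1,k;z)$ and $\mathrm{JS}(n,k;z)=\mathrm{JS}(n-1,k-1;z)+k(k+z)\mathrm{JS}(n-1,k;z)$, with $\mathrm{JS}(0,0;z)=\mathrm{js}(0,0;z)=1$ and $\mathrm{JS}(j,0;z)=\mathrm{JS}(0,j;z)=\mathrm{js}(j,0;z)=\mathrm{js}(0,j;z)=0$ for $j\geq1$. $F_k(x;z)=\sum_{n\geq0}\mathrm{JS}(k+n,n;z)x^n$, which is a rational function of $x$ (of the form $A_k(x;z)/(1-x)^{3k+1}$ with $A_k$ a polynomial); the identity is understood as an identity of rational functions in $x$. -}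

module Defs where

open import Data.Nat using (ℕ; zero; suc; _∸_; _≤?_; _<?_)
open import Data.Integer using (ℤ; +_; _+_; _*_; -_; 0ℤ; 1ℤ)
open import Data.List using (List; []; _∷_; length)
open import Relation.Nullary using (yes; no)

js : ℕ → ℕ → ℤ → ℤ
js zero    zero    z = 1ℤ
js zero    (suc k) z = 0ℤ
js (suc n) zero    z = 0ℤ
js (suc n) (suc k) z = js n k z + ((+ n) * ((+ n) + z)) * js n (suc k) z

JS : ℕ → ℕ → ℤ → ℤ
JS zero    zero    z = 1ℤ
JS zero    (suc k) z = 0ℤ
JS (suc n) zero    z = 0ℤ
JS (suc n) (suc k) z = JS n k z + ((+ suc k) * ((+ suc k) + z)) * JS n (suc k) z

PS : Set
PS = ℕ → ℤ

sumTo : ℕ → (ℕ → ℤ) → ℤ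
sumTo zero    f = f zero
sumTo (suc n) f = sumTo n f + f (suc n)

_⊛_ : PS → PS → PS
(f ⊛ g) n = sumTo n (λ i → f i * g (n ∸ i))

one : PS
one zero    = 1ℤ
one (suc n) = 0ℤ

oneMinusX : PS
oneMinusX zero          = 1ℤ
oneMinusX (suc zero)    = - 1ℤ
oneMinusX (suc (suc n)) = 0ℤ

xMinusOne : PS
xMinusOne zero          = - 1ℤ
xMinusOne (suc zero)    = 1ℤ
xMinusOne (suc (suc n)) = 0ℤ

_^ps_ : PS → ℕ → PS
p ^ps zero    = one
p ^ps (suc m) = p ⊛ (p ^ps m)

shift : ℕ → PS → PS
shift L f n with n <? L
... | yes _ = 0ℤ
... | no  _ = f (n ∸ L)

poly : List ℤ → PS
poly []       n       = 0ℤ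
poly (c ∷ a)  zero    = c
poly (c ∷ a)  (suc n) = poly a n

-- reversed polynomial x^L · A(1/x), where L = length a (so deg A < L)
revPoly : List ℤ → PS
revPoly a j with j ≤? length a
... | yes _ = poly a (length a ∸ j)
... | no  _ = 0ℤ

_·ps_ : ℤ → PS → PS
(c ·ps f) n = c * f n

sgn : ℕ → ℤ
sgn zero    = 1ℤ
sgn (suc n) = - sgn n

F : ℕ → ℤ → PS
F k z n = JS (k Data.Nat.+ n) n z

G : ℕ → ℤ → PS
G k z n with n <? k
... | yes _ = 0ℤ
... | no  _ = js n (n ∸ k) z

-- For n ≥ 0, JS(k+n,n;z) = P_k(n), where P_k is the polynomial with P_0 = 1,
-- ∇P_{k+1}(N) = N(N+z)P_k(N) and P_{k+1}(0) = 0 (∇ the backward difference); the recurrence of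
-- js, which is the same recurrence run at negative arguments, gives js(n,n-k;z) = (-1)^k P_k(-n)
-- with -z in place of z. The theorem is therefore an instance of reciprocity for polynomial
-- sequences. Extending a power series by zero to a function on ℤ, multiplication by 1 - x
-- becomes ∇ and multiplication by x - 1 becomes -∇. If (Σ_{n≥0} p(n)xⁿ)(1-x)^m = A(x), then
-- ∇^m p agrees with the coefficients of A from m on, so this polynomial vanishes for large
-- arguments and hence everywhere. Thus ∇^m maps the restriction of p to negative arguments to -A,
-- and, with L the number of coefficients of A, the reflection N ↦ L + m - N turns this into
-- x^L (Σ_{n≥1} p(-n)xⁿ)(x-1)^m = -x^m x^L A(1/x).

module Submission where

open import Defs
open import Data.Nat using (ℕ; suc; _≥_)
open import Data.Integer using (ℤ; -_)
open import Data.List using (List; length)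
open import Relation.Binary.PropositionalEquality using (_≡_)

open import Data.Nat as ℕ using (zero; _≤_; _<_; _∸_; s≤s; _<?_; _≤?_)
import Data.Nat.Properties as ℕₚ
open import Data.Integer using (+_; -[1+_]; 0ℤ; 1ℤ; -1ℤ; _+_; _*_; _-_; pred)
import Data.Integer.Properties as ℤₚ
open import Data.Integer.Tactic.RingSolver using (solve-∀)
open import Data.List using ([]; _∷_)
open import Data.Product using (∃-syntax; _,_)
open import Function using (_∘_; const)
open import Relation.Binary.Definitions using (tri<; tri≈; tri>)
open import Relation.Nullary using (yes; no; contradiction)
open import Relation.Binary.PropositionalEquality
  using (refl; sym; trans; cong; cong₂; cong-app; subst; _≗_; module ≡-Reasoning)

open ≡-Reasoning

iterate : {A : Set} → (A → A) → ℕ → A → A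
iterate T zero    x = x
iterate T (suc m) x = iterate T m (T x)

iterate-comm : ∀ {A : Set} (T : A → A) m x → iterate T m (T x) ≡ T (iterate T m x)
iterate-comm T zero    x = refl
iterate-comm T (suc m) x = iterate-comm T m (T x)

Congruent : ((ℤ → ℤ) → ℤ → ℤ) → Set
Congruent T = ∀ {u v} → u ≗ v → T u ≗ T v

iterate-cong : ∀ {T} → Congruent T → ∀ m → Congruent (iterate T m)
iterate-cong T-cong zero    e = e
iterate-cong T-cong (suc m) e = iterate-cong T-cong m (T-cong e)

-- Differences

∇ : (ℤ → ℤ) → ℤ → ℤ
∇ u N = u N - u (pred N)

-∇ : (ℤ → ℤ) → ℤ → ℤ
-∇ u N = u (pred N) - u N

∇-cong : Congruent ∇
∇-cong e N = cong₂ _-_ (e N) (e (pred N))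

-∇-cong : Congruent -∇
-∇-cong e N = cong₂ _-_ (e (pred N)) (e N)

∇-linear : ∀ a b u v → ∇ (λ N → a * u N + b * v N) ≗ λ N → a * ∇ u N + b * ∇ v N
∇-linear a b u v N = distrib a b (u N) (v N) (u (pred N)) (v (pred N))
  where
  distrib : ∀ a b x y x′ y′ → (a * x + b * y) - (a * x′ + b * y′) ≡ a * (x - x′) + b * (y - y′)
  distrib = solve-∀

∇^-linear : ∀ m a b u v →
  iterate ∇ m (λ N → a * u N + b * v N) ≗ λ N → a * iterate ∇ m u N + b * iterate ∇ m v N
∇^-linear zero    a b u v N = refl
∇^-linear (suc m) a b u v N =
  trans (iterate-cong ∇-cong m (∇-linear a b u v) N) (∇^-linear m a b (∇ u) (∇ v) N)

∇^-pred : ∀ d u → iterate ∇ d (u ∘ pred) ≡ iterate ∇ d u ∘ pred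
∇^-pred zero    u = refl
∇^-pred (suc d) u = ∇^-pred d (∇ u)

-∇-reflect : ∀ K u → -∇ (λ N → u (K - N)) ≗ λ N → ∇ u (1ℤ + K - N)
-∇-reflect K u N = cong₂ _-_ (cong u (shift-in K N)) (cong u (shift-out K N))
  where
  shift-in : ∀ K N → K - (-1ℤ + N) ≡ 1ℤ + K - N
  shift-in = solve-∀
  shift-out : ∀ K N → K - N ≡ -1ℤ + (1ℤ + K - N)
  shift-out = solve-∀

-∇^-reflect : ∀ m K u → iterate -∇ m (λ N → u (K - N)) ≗ λ N → iterate ∇ m u (K + + m - N)
-∇^-reflect zero    K u N = cong (λ t → u (t - N)) (sym (ℤₚ.+-identityʳ K))
-∇^-reflect (suc m) K u N = begin
  iterate -∇ m (-∇ (λ N → u (K - N))) N    ≡⟨ iterate-cong -∇-cong m (-∇-reflect K u) N ⟩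
  iterate -∇ m (λ N → ∇ u (1ℤ + K - N)) N  ≡⟨ -∇^-reflect m (1ℤ + K) (∇ u) N ⟩
  iterate ∇ m (∇ u) (1ℤ + K + + m - N)     ≡⟨ cong (iterate ∇ m (∇ u)) (reassoc K (+ m) N) ⟩
  iterate ∇ m (∇ u) (K + + suc m - N)      ∎
  where
  reassoc : ∀ K M N → 1ℤ + K + M - N ≡ K + (1ℤ + M) - N
  reassoc = solve-∀

∇-const0 : ∀ u → u ≗ const 0ℤ → ∇ u ≗ const 0ℤ
∇-const0 u e N = cong₂ _-_ (e N) (e (pred N))

∇≗0⇒pred-invariant : ∀ u → ∇ u ≗ const 0ℤ → ∀ N → u (pred N) ≡ u N
∇≗0⇒pred-invariant u e N = sym (ℤₚ.i-j≡0⇒i≡j (u N) (u (pred N)) (e N))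

∇≗0⇒constant : ∀ u → ∇ u ≗ const 0ℤ → ∀ N → u N ≡ u (+ 0)
∇≗0⇒constant u e (+ zero)     = refl
∇≗0⇒constant u e (+ suc n)    =
  trans (sym (∇≗0⇒pred-invariant u e (+ suc n))) (∇≗0⇒constant u e (+ n))
∇≗0⇒constant u e -[1+ zero ]  = ∇≗0⇒pred-invariant u e (+ 0)
∇≗0⇒constant u e -[1+ suc n ] =
  trans (∇≗0⇒pred-invariant u e -[1+ n ]) (∇≗0⇒constant u e -[1+ n ])

-- Polynomial functions

-- Since iterate applies ∇ innermost, Poly< (suc d) u is definitionally Poly< d (∇ u).
Poly< : ℕ → (ℤ → ℤ) → Set
Poly< d u = iterate ∇ d u ≗ const 0ℤ

Polynomial : (ℤ → ℤ) → Set
Polynomial p = ∃[ d ] Poly< d p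

Poly<-cong : ∀ d {u v} → u ≗ v → Poly< d u → Poly< d v
Poly<-cong d e p N = trans (sym (iterate-cong ∇-cong d e N)) (p N)

Poly<-suc : ∀ d u → Poly< d u → Poly< (suc d) u
Poly<-suc d u p N = trans (cong-app (iterate-comm ∇ d u) N) (∇-const0 (iterate ∇ d u) p N)

Poly<-∇^ : ∀ m d u → Poly< d u → Poly< d (iterate ∇ m u)
Poly<-∇^ zero    d u p = p
Poly<-∇^ (suc m) d u p = Poly<-∇^ m d (∇ u) (Poly<-suc d u p)

Poly<-linear : ∀ d a b u v → Poly< d u → Poly< d v → Poly< d (λ N → a * u N + b * v N)
Poly<-linear d a b u v p q N = begin
  iterate ∇ d (λ N → a * u N + b * v N) N          ≡⟨ ∇^-linear d a b u v N ⟩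
  a * iterate ∇ d u N + b * iterate ∇ d v N        ≡⟨ cong₂ (λ x y → a * x + b * y) (p N) (q N) ⟩
  a * 0ℤ + b * 0ℤ                                  ≡⟨ annihilate a b ⟩
  0ℤ                                               ∎
  where
  annihilate : ∀ a b → a * 0ℤ + b * 0ℤ ≡ 0ℤ
  annihilate = solve-∀

Poly<-pred : ∀ d u → Poly< d u → Poly< d (u ∘ pred)
Poly<-pred d u p N = trans (cong-app (∇^-pred d u) N) (p (pred N))

Poly<-* : ∀ d u → Poly< d u → Poly< (suc d) (λ N → N * u N)
Poly<-* zero    u p N = begin
  N * u N - (-1ℤ + N) * u (pred N)  ≡⟨ cong₂ (λ x y → N * x - (-1ℤ + N) * y) (p N) (p (pred N)) ⟩
  N * 0ℤ - (-1ℤ + N) * 0ℤ            ≡⟨ annihilate N ⟩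
  0ℤ                                 ∎
  where
  annihilate : ∀ N → N * 0ℤ - (-1ℤ + N) * 0ℤ ≡ 0ℤ
  annihilate = solve-∀
Poly<-* (suc d) u p =
  Poly<-cong (suc d) (λ N → sym (product-rule N (u N) (u (pred N))))
    (Poly<-linear (suc d) 1ℤ 1ℤ (λ N → N * ∇ u N) (u ∘ pred) (Poly<-* d (∇ u) p) (Poly<-pred (suc d) u p))
  where
  product-rule : ∀ N x y → N * x - (-1ℤ + N) * y ≡ 1ℤ * (N * (x - y)) + 1ℤ * y
  product-rule = solve-∀

AgreeFrom : ℕ → (ℤ → ℤ) → (ℤ → ℤ) → Set
AgreeFrom B u v = ∀ n → B ≤ n → u (+ n) ≡ v (+ n)

∇-agreeFrom : ∀ B u v → AgreeFrom B u v → AgreeFrom (suc B) (∇ u) (∇ v)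
∇-agreeFrom B u v e (suc n) (s≤s B≤n) = cong₂ _-_ (e (suc n) (ℕₚ.m≤n⇒m≤1+n B≤n)) (e n B≤n)

∇^-agreeFrom : ∀ m B u v → AgreeFrom B u v → AgreeFrom (m ℕ.+ B) (iterate ∇ m u) (iterate ∇ m v)
∇^-agreeFrom zero    B u v e = e
∇^-agreeFrom (suc m) B u v e n m+B≤n =
  ∇^-agreeFrom m (suc B) (∇ u) (∇ v) (∇-agreeFrom B u v e) n
    (subst (_≤ n) (sym (ℕₚ.+-suc m B)) m+B≤n)

Poly<-eventually-0 : ∀ d B u → Poly< d u → AgreeFrom B u (const 0ℤ) → u ≗ const 0ℤ
Poly<-eventually-0 zero    B u p e = p
Poly<-eventually-0 (suc d) B u p e N = begin
  u N      ≡⟨ ∇≗0⇒constant u ∇u≗0 N ⟩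
  u (+ 0)  ≡⟨ sym (∇≗0⇒constant u ∇u≗0 (+ B)) ⟩
  u (+ B)  ≡⟨ e B ℕₚ.≤-refl ⟩
  0ℤ       ∎
  where
  ∇u≗0 : ∇ u ≗ const 0ℤ
  ∇u≗0 = Poly<-eventually-0 d (suc B) (∇ u) p (∇-agreeFrom B u (const 0ℤ) e)

∇⁻¹ : (ℤ → ℤ) → ℤ → ℤ
∇⁻¹ f (+ zero)     = 0ℤ
∇⁻¹ f (+ suc n)    = ∇⁻¹ f (+ n) + f (+ suc n)
∇⁻¹ f -[1+ zero ]  = - f (+ 0)
∇⁻¹ f -[1+ suc n ] = ∇⁻¹ f -[1+ n ] - f -[1+ n ]

∇-∇⁻¹ : ∀ f → ∇ (∇⁻¹ f) ≗ f
∇-∇⁻¹ f (+ zero)  = cancel (f (+ 0))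
  where cancel : ∀ x → 0ℤ - (- x) ≡ x
        cancel = solve-∀
∇-∇⁻¹ f (+ suc n) = cancel (∇⁻¹ f (+ n)) (f (+ suc n))
  where cancel : ∀ a x → (a + x) - a ≡ x
        cancel = solve-∀
∇-∇⁻¹ f -[1+ n ]  = cancel (∇⁻¹ f -[1+ n ]) (f -[1+ n ])
  where cancel : ∀ a x → a - (a - x) ≡ x
        cancel = solve-∀

Poly<-∇⁻¹ : ∀ d f → Poly< d f → Poly< (suc d) (∇⁻¹ f)
Poly<-∇⁻¹ d f = Poly<-cong d (λ N → sym (∇-∇⁻¹ f N))

-- Power series as functions on ℤ

sumTo-cong : ∀ n {f g} → (∀ i → i ≤ n → f i ≡ g i) → sumTo n f ≡ sumTo n g
sumTo-cong zero    e = e 0 ℕ.z≤n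
sumTo-cong (suc n) e =
  cong₂ _+_ (sumTo-cong n (λ i i≤n → e i (ℕₚ.m≤n⇒m≤1+n i≤n))) (e (suc n) ℕₚ.≤-refl)

sumTo-linear : ∀ n a b f g → sumTo n (λ i → a * f i + b * g i) ≡ a * sumTo n f + b * sumTo n g
sumTo-linear zero    a b f g = refl
sumTo-linear (suc n) a b f g =
  trans (cong (_+ (a * f (suc n) + b * g (suc n))) (sumTo-linear n a b f g))
        (regroup a b (sumTo n f) (sumTo n g) (f (suc n)) (g (suc n)))
  where
  regroup : ∀ a b x y x′ y′ → (a * x + b * y) + (a * x′ + b * y′) ≡ a * (x + x′) + b * (y + y′)
  regroup = solve-∀

sumTo-suc : ∀ n f → sumTo (suc n) f ≡ f 0 + sumTo n (f ∘ suc)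
sumTo-suc zero    f = refl
sumTo-suc (suc n) f = trans (cong (_+ f (suc (suc n))) (sumTo-suc n f)) (ℤₚ.+-assoc (f 0) _ _)

sumTo-zero : ∀ n {f} → (∀ i → i ≤ n → f i ≡ 0ℤ) → sumTo n f ≡ 0ℤ
sumTo-zero n e = trans (sumTo-cong n e) (sumTo-const0 n)
  where
  sumTo-const0 : ∀ n → sumTo n (const 0ℤ) ≡ 0ℤ
  sumTo-const0 zero    = refl
  sumTo-const0 (suc n) = cong (_+ 0ℤ) (sumTo-const0 n)

mulX : PS → PS
mulX q zero    = 0ℤ
mulX q (suc n) = q n

∸-suc : ∀ {i n} → i ≤ n → suc n ∸ i ≡ suc (n ∸ i)
∸-suc = ℕₚ.+-∸-assoc 1

⊛-one : ∀ f n → (f ⊛ one) n ≡ f n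
⊛-one f zero    = ℤₚ.*-identityʳ (f 0)
⊛-one f (suc n) = begin
  sumTo n (λ i → f i * one (suc n ∸ i)) + f (suc n) * one (n ∸ n)
    ≡⟨ cong₂ _+_ (sumTo-zero n below-diagonal) (cong (λ j → f (suc n) * one j) (ℕₚ.n∸n≡0 n)) ⟩
  0ℤ + f (suc n) * 1ℤ
    ≡⟨ trans (ℤₚ.+-identityˡ _) (ℤₚ.*-identityʳ (f (suc n))) ⟩
  f (suc n) ∎
  where
  below-diagonal : ∀ i → i ≤ n → f i * one (suc n ∸ i) ≡ 0ℤ
  below-diagonal i i≤n = trans (cong (λ j → f i * one j) (∸-suc i≤n)) (ℤₚ.*-zeroʳ (f i))

⊛-mulX : ∀ f q n → (f ⊛ mulX q) n ≡ mulX (f ⊛ q) n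
⊛-mulX f q zero    = ℤₚ.*-zeroʳ (f 0)
⊛-mulX f q (suc n) = begin
  sumTo n (λ i → f i * mulX q (suc n ∸ i)) + f (suc n) * mulX q (n ∸ n)
    ≡⟨ cong₂ _+_ (sumTo-cong n (λ i i≤n → cong (λ j → f i * mulX q j) (∸-suc i≤n)))
                 (cong (λ j → f (suc n) * mulX q j) (ℕₚ.n∸n≡0 n)) ⟩
  (f ⊛ q) n + f (suc n) * 0ℤ
    ≡⟨ trans (cong (_+_ ((f ⊛ q) n)) (ℤₚ.*-zeroʳ (f (suc n)))) (ℤₚ.+-identityʳ _) ⟩
  (f ⊛ q) n ∎

AtMostLinear : PS → Set
AtMostLinear c = ∀ i → c (suc (suc i)) ≡ 0ℤ

atMostLinear-⊛ : ∀ c q → AtMostLinear c → ∀ n → (c ⊛ q) n ≡ c 0 * q n + c 1 * mulX q n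
atMostLinear-⊛ c q lin zero    = sym (trans (cong (_+_ (c 0 * q 0)) (ℤₚ.*-zeroʳ (c 1))) (ℤₚ.+-identityʳ _))
atMostLinear-⊛ c q lin (suc n) =
  trans (sumTo-suc n (λ i → c i * q (suc n ∸ i))) (cong (_+_ (c 0 * q (suc n))) (only-first n))
  where
  only-first : ∀ n → sumTo n (λ i → c (suc i) * q (n ∸ i)) ≡ c 1 * q n
  only-first zero    = refl
  only-first (suc n) = begin
    sumTo (suc n) (λ i → c (suc i) * q (suc n ∸ i))
      ≡⟨ sumTo-suc n _ ⟩
    c 1 * q (suc n) + sumTo n (λ i → c (suc (suc i)) * q (n ∸ i))
      ≡⟨ cong (_+_ (c 1 * q (suc n))) (sumTo-zero n (λ i _ → cong (_* q (n ∸ i)) (lin i))) ⟩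
    c 1 * q (suc n) + 0ℤ
      ≡⟨ ℤₚ.+-identityʳ _ ⟩
    c 1 * q (suc n) ∎

⊛-atMostLinear : ∀ f c q → AtMostLinear c →
  ∀ n → (f ⊛ (c ⊛ q)) n ≡ c 0 * (f ⊛ q) n + c 1 * mulX (f ⊛ q) n
⊛-atMostLinear f c q lin n = begin
  sumTo n (λ i → f i * (c ⊛ q) (n ∸ i))
    ≡⟨ sumTo-cong n (λ i _ → trans (cong (f i *_) (atMostLinear-⊛ c q lin (n ∸ i)))
                                     (distrib (f i) (c 0) (c 1) (q (n ∸ i)) (mulX q (n ∸ i)))) ⟩
  sumTo n (λ i → c 0 * (f i * q (n ∸ i)) + c 1 * (f i * mulX q (n ∸ i)))
    ≡⟨ sumTo-linear n (c 0) (c 1) _ _ ⟩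
  c 0 * (f ⊛ q) n + c 1 * (f ⊛ mulX q) n
    ≡⟨ cong (λ x → c 0 * (f ⊛ q) n + c 1 * x) (⊛-mulX f q n) ⟩
  c 0 * (f ⊛ q) n + c 1 * mulX (f ⊛ q) n ∎
  where
  distrib : ∀ x a b y y′ → x * (a * y + b * y′) ≡ a * (x * y) + b * (x * y′)
  distrib = solve-∀

zeroExt : PS → ℤ → ℤ
zeroExt h (+ n)    = h n
zeroExt h -[1+ n ] = 0ℤ

zeroExt-cong : ∀ {h h′} → (∀ n → h n ≡ h′ n) → zeroExt h ≗ zeroExt h′
zeroExt-cong e (+ n)    = e n
zeroExt-cong e -[1+ n ] = refl

zeroExt-mulX : ∀ h → zeroExt (mulX h) ≗ zeroExt h ∘ pred
zeroExt-mulX h (+ zero)  = refl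
zeroExt-mulX h (+ suc n) = refl
zeroExt-mulX h -[1+ n ]  = refl

zeroExt-⊛-atMostLinear : ∀ f c q → AtMostLinear c →
  zeroExt (f ⊛ (c ⊛ q)) ≗ λ N → c 0 * zeroExt (f ⊛ q) N + c 1 * zeroExt (f ⊛ q) (pred N)
zeroExt-⊛-atMostLinear f c q lin (+ n)    =
  trans (⊛-atMostLinear f c q lin n) (cong (_+_ (c 0 * (f ⊛ q) n)) (cong (c 1 *_) (zeroExt-mulX (f ⊛ q) (+ n))))
zeroExt-⊛-atMostLinear f c q lin -[1+ n ] = sym (annihilate (c 0) (c 1))
  where
  annihilate : ∀ a b → a * 0ℤ + b * 0ℤ ≡ 0ℤ
  annihilate = solve-∀

zeroExt-⊛-^ps : ∀ c T → AtMostLinear c → (∀ u N → T u N ≡ c 0 * u N + c 1 * u (pred N)) →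
  ∀ f m → zeroExt (f ⊛ (c ^ps m)) ≗ iterate T m (zeroExt f)
zeroExt-⊛-^ps c T lin T-def f zero    = zeroExt-cong (⊛-one f)
zeroExt-⊛-^ps c T lin T-def f (suc m) N = begin
  zeroExt (f ⊛ (c ⊛ (c ^ps m))) N             ≡⟨ zeroExt-⊛-atMostLinear f c (c ^ps m) lin N ⟩
  c 0 * u N + c 1 * u (pred N)                ≡⟨ sym (T-def u N) ⟩
  T u N                                       ≡⟨ T-cong (zeroExt-⊛-^ps c T lin T-def f m) N ⟩
  T (iterate T m (zeroExt f)) N               ≡⟨ sym (cong-app (iterate-comm T m (zeroExt f)) N) ⟩
  iterate T m (T (zeroExt f)) N               ∎
  where
  u = zeroExt (f ⊛ (c ^ps m))
  T-cong : Congruent T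
  T-cong {v} {w} e N = trans (T-def v N) (trans (cong₂ (λ x y → c 0 * x + c 1 * y) (e N) (e (pred N)))
                                                (sym (T-def w N)))

zeroExt-⊛-oneMinusX^ : ∀ f m → zeroExt (f ⊛ (oneMinusX ^ps m)) ≗ iterate ∇ m (zeroExt f)
zeroExt-⊛-oneMinusX^ = zeroExt-⊛-^ps oneMinusX ∇ (λ _ → refl) (λ u N → ∇-as-linear (u N) (u (pred N)))
  where
  ∇-as-linear : ∀ x y → x - y ≡ 1ℤ * x + - 1ℤ * y
  ∇-as-linear = solve-∀

zeroExt-⊛-xMinusOne^ : ∀ f m → zeroExt (f ⊛ (xMinusOne ^ps m)) ≗ iterate -∇ m (zeroExt f)
zeroExt-⊛-xMinusOne^ = zeroExt-⊛-^ps xMinusOne -∇ (λ _ → refl) (λ u N → -∇-as-linear (u N) (u (pred N)))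
  where
  -∇-as-linear : ∀ x y → y - x ≡ - 1ℤ * x + 1ℤ * y
  -∇-as-linear = solve-∀

zeroExt-neg : ∀ h {k} → 0 < k → zeroExt h (- + k) ≡ 0ℤ
zeroExt-neg h (s≤s _) = refl

zeroExt-sub-≥ : ∀ h {m n} → n ≤ m → zeroExt h (+ m - + n) ≡ h (m ∸ n)
zeroExt-sub-≥ h {m} {n} n≤m = cong (zeroExt h) (trans (ℤₚ.m-n≡m⊖n m n) (ℤₚ.⊖-≥ n≤m))

zeroExt-sub-< : ∀ h {m n} → m < n → zeroExt h (+ m - + n) ≡ 0ℤ
zeroExt-sub-< h {m} {n} m<n =
  trans (cong (zeroExt h) (trans (ℤₚ.m-n≡m⊖n m n) (ℤₚ.⊖-< m<n))) (zeroExt-neg h (ℕₚ.m<n⇒0<n∸m m<n))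

zeroExt-shift : ∀ L h → zeroExt (shift L h) ≗ λ N → zeroExt h (N - + L)
zeroExt-shift L       h (+ n) with n <? L
... | yes n<L = sym (zeroExt-sub-< h n<L)
... | no  n≮L = sym (zeroExt-sub-≥ h (ℕₚ.≮⇒≥ n≮L))
zeroExt-shift zero    h -[1+ n ] = refl
zeroExt-shift (suc L) h -[1+ n ] = refl

poly-length : ∀ a {n} → length a ≤ n → poly a n ≡ 0ℤ
poly-length []      _       = refl
poly-length (c ∷ a) (s≤s p) = poly-length a p

zeroExt-revPoly : ∀ a → zeroExt (revPoly a) ≗ λ N → zeroExt (poly a) (+ length a - N)
zeroExt-revPoly a (+ j) with j ≤? length a
... | yes j≤L = sym (zeroExt-sub-≥ (poly a) j≤L)
... | no  j≰L = sym (zeroExt-sub-< (poly a) (ℕₚ.≰⇒> j≰L))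
zeroExt-revPoly a -[1+ j ] = sym (poly-length a (ℕₚ.m≤m+n (length a) (suc j)))

-- Reciprocity

zeroExt-reflection : ∀ (p : ℤ → ℤ) (f g : PS) c →
  (∀ n → f n ≡ p (+ n)) → g 0 ≡ 0ℤ → (∀ n → g (suc n) ≡ c * p -[1+ n ]) →
  zeroExt g ≗ λ N → c * p (- N) + (- c) * zeroExt f (- N)
zeroExt-reflection p f g c f≡p g0 g≡p (+ zero)    = begin
  g 0                                ≡⟨ g0 ⟩
  0ℤ                                 ≡⟨ cancel c (p (+ 0)) ⟩
  c * p (+ 0) + (- c) * p (+ 0)      ≡⟨ cong (λ x → c * p (+ 0) + (- c) * x) (sym (f≡p 0)) ⟩
  c * p (+ 0) + (- c) * f 0          ∎
  where
  cancel : ∀ c x → 0ℤ ≡ c * x + (- c) * x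
  cancel = solve-∀
zeroExt-reflection p f g c f≡p g0 g≡p (+ suc n)   =
  trans (g≡p n) (pad (c * p -[1+ n ]) (- c))
  where
  pad : ∀ x b → x ≡ x + b * 0ℤ
  pad = solve-∀
zeroExt-reflection p f g c f≡p g0 g≡p -[1+ n ] =
  trans (cancel c (p (+ suc n))) (cong (λ x → c * p (+ suc n) + (- c) * x) (sym (f≡p (suc n))))
  where
  cancel : ∀ c x → 0ℤ ≡ c * x + (- c) * x
  cancel = solve-∀

denominator⇒∇^≗0 : ∀ d m p f (a : List ℤ) → Poly< d p → (∀ n → f n ≡ p (+ n)) →
  iterate ∇ m (zeroExt f) ≗ zeroExt (poly a) → iterate ∇ m p ≗ const 0ℤ
denominator⇒∇^≗0 d m p f a p-poly f≡p ∇^m-f≗a =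
  Poly<-eventually-0 d (m ℕ.+ length a) (iterate ∇ m p) (Poly<-∇^ m d p p-poly) vanishes
  where
  vanishes : AgreeFrom (m ℕ.+ length a) (iterate ∇ m p) (const 0ℤ)
  vanishes j m+L≤j = begin
    iterate ∇ m p (+ j)            ≡⟨ ∇^-agreeFrom m 0 p (zeroExt f) (λ i _ → sym (f≡p i)) j m≤j ⟩
    iterate ∇ m (zeroExt f) (+ j)  ≡⟨ ∇^m-f≗a (+ j) ⟩
    poly a j                       ≡⟨ poly-length a L≤j ⟩
    0ℤ                             ∎
    where
    m≤j : m ℕ.+ 0 ≤ j
    m≤j = ℕₚ.≤-trans (ℕₚ.+-monoʳ-≤ m ℕ.z≤n) m+L≤j
    L≤j : length a ≤ j
    L≤j = ℕₚ.≤-trans (ℕₚ.m≤n+m (length a) m) m+L≤j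

shift-revPoly : ∀ m a n → shift m (revPoly a) n ≡ zeroExt (poly a) (+ length a + + m - + n)
shift-revPoly m a n = begin
  shift m (revPoly a) n                         ≡⟨ zeroExt-shift m (revPoly a) (+ n) ⟩
  zeroExt (revPoly a) (+ n - + m)               ≡⟨ zeroExt-revPoly a (+ n - + m) ⟩
  zeroExt (poly a) (+ length a - (+ n - + m))   ≡⟨ cong (zeroExt (poly a)) (reassoc (+ length a) (+ m) (+ n)) ⟩
  zeroExt (poly a) (+ length a + + m - + n)     ∎
  where
  reassoc : ∀ L m n → L - (n - m) ≡ L + m - n
  reassoc = solve-∀

reciprocity : ∀ (p : ℤ → ℤ) (f g : PS) c m (a : List ℤ) → Polynomial p →
  (∀ n → f n ≡ p (+ n)) → g 0 ≡ 0ℤ → (∀ n → g (suc n) ≡ c * p -[1+ n ]) →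
  (∀ n → (f ⊛ (oneMinusX ^ps m)) n ≡ poly a n) →
  ∀ n → (shift (length a) g ⊛ (xMinusOne ^ps m)) n ≡ (- c) * shift m (revPoly a) n
reciprocity p f g c m a (d , p-poly) f≡p g0 g≡p numerator n = begin
  (shift L g ⊛ (xMinusOne ^ps m)) n
    ≡⟨ zeroExt-⊛-xMinusOne^ (shift L g) m (+ n) ⟩
  iterate -∇ m (zeroExt (shift L g)) (+ n)
    ≡⟨ iterate-cong -∇-cong m zeroExt-shift-g (+ n) ⟩
  iterate -∇ m (λ N → v (+ L - N)) (+ n)
    ≡⟨ -∇^-reflect m (+ L) v (+ n) ⟩
  iterate ∇ m v K
    ≡⟨ ∇^-linear m c (- c) p (zeroExt f) K ⟩
  c * iterate ∇ m p K + (- c) * iterate ∇ m (zeroExt f) K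
    ≡⟨ cong₂ (λ x y → c * x + (- c) * y)
             (denominator⇒∇^≗0 d m p f a p-poly f≡p ∇^m-f≗a K) (∇^m-f≗a K) ⟩
  c * 0ℤ + (- c) * zeroExt (poly a) K
    ≡⟨ drop c (zeroExt (poly a) K) ⟩
  (- c) * zeroExt (poly a) K
    ≡⟨ cong ((- c) *_) (sym (shift-revPoly m a n)) ⟩
  (- c) * shift m (revPoly a) n ∎
  where
  L = length a
  K = + L + + m - + n

  v : ℤ → ℤ
  v N = c * p N + (- c) * zeroExt f N

  ∇^m-f≗a : iterate ∇ m (zeroExt f) ≗ zeroExt (poly a)
  ∇^m-f≗a N = trans (sym (zeroExt-⊛-oneMinusX^ f m N)) (zeroExt-cong numerator N)

  zeroExt-shift-g : zeroExt (shift L g) ≗ λ N → v (+ L - N)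
  zeroExt-shift-g N = begin
    zeroExt (shift L g) N   ≡⟨ zeroExt-shift L g N ⟩
    zeroExt g (N - + L)     ≡⟨ zeroExt-reflection p f g c f≡p g0 g≡p (N - + L) ⟩
    v (- (N - + L))         ≡⟨ cong v (flip N (+ L)) ⟩
    v (+ L - N)             ∎
    where
    flip : ∀ N L → - (N - L) ≡ L - N
    flip = solve-∀

  drop : ∀ c x → c * 0ℤ + (- c) * x ≡ (- c) * x
  drop = solve-∀

-- Jacobi-Stirling numbers

i+j*0≡i : ∀ i j → i + j * 0ℤ ≡ i
i+j*0≡i = solve-∀

JS-zero : ∀ {n k} z → n < k → JS n k z ≡ 0ℤ
JS-zero {zero}  {suc k} z _         = refl
JS-zero {suc n} {suc k} z (s≤s n<k) =
  trans (cong₂ (λ x y → x + (+ suc k * (+ suc k + z)) * y) (JS-zero z n<k) (JS-zero z (ℕₚ.m<n⇒m<1+n n<k)))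
        (i+j*0≡i 0ℤ (+ suc k * (+ suc k + z)))

JS-diag : ∀ n z → JS n n z ≡ 1ℤ
JS-diag zero    z = refl
JS-diag (suc n) z =
  trans (cong₂ (λ x y → x + (+ suc n * (+ suc n + z)) * y) (JS-diag n z) (JS-zero {n} z ℕₚ.≤-refl))
        (i+j*0≡i 1ℤ (+ suc n * (+ suc n + z)))

js-zero : ∀ {n k} z → n < k → js n k z ≡ 0ℤ
js-zero {zero}  {suc k} z _         = refl
js-zero {suc n} {suc k} z (s≤s n<k) =
  trans (cong₂ (λ x y → x + (+ n * (+ n + z)) * y) (js-zero z n<k) (js-zero z (ℕₚ.m<n⇒m<1+n n<k)))
        (i+j*0≡i 0ℤ (+ n * (+ n + z)))

js-diag : ∀ n z → js n n z ≡ 1ℤ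
js-diag zero    z = refl
js-diag (suc n) z =
  trans (cong₂ (λ x y → x + (+ n * (+ n + z)) * y) (js-diag n z) (js-zero {n} z ℕₚ.≤-refl))
        (i+j*0≡i 1ℤ (+ n * (+ n + z)))

-- The weight n (n + z) kills js(n,0;z) also for n = 0, where js(0,0;z) = 1.
js-0-weighted : ∀ n z → (+ n * (+ n + z)) * js n 0 z ≡ 0ℤ
js-0-weighted zero    z = refl
js-0-weighted (suc n) z = ℤₚ.*-zeroʳ (+ suc n * (+ suc n + z))

G-< : ∀ {k} z {n} → n < k → G k z n ≡ 0ℤ
G-< {k} z {n} n<k with n <? k
... | yes _   = refl
... | no  n≮k = contradiction n<k n≮k

G-≥ : ∀ {k} z {n} → k ≤ n → G k z n ≡ js n (n ∸ k) z
G-≥ {k} z {n} k≤n with n <? k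
... | yes n<k = contradiction k≤n (ℕₚ.<⇒≱ n<k)
... | no  _   = refl

G-rec : ∀ k z n → G (suc k) z (suc n) ≡ G (suc k) z n + (+ n * (+ n + z)) * G k z n
G-rec k z n with ℕₚ.<-cmp n k
... | tri< n<k _ _
  rewrite G-< {suc k} z (s≤s n<k) | G-< {suc k} z (ℕₚ.m<n⇒m<1+n n<k) | G-< z n<k
  = sym (i+j*0≡i 0ℤ (+ n * (+ n + z)))
... | tri≈ _ refl _
  rewrite G-≥ {suc n} z ℕₚ.≤-refl | G-< {suc n} z (ℕₚ.n<1+n n) | G-≥ {n} z ℕₚ.≤-refl | ℕₚ.n∸n≡0 n
  = sym (trans (ℤₚ.+-identityˡ _) (js-0-weighted n z))
... | tri> _ _ k<n
  rewrite G-≥ z (s≤s (ℕₚ.<⇒≤ k<n)) | G-≥ z k<n | G-≥ z (ℕₚ.<⇒≤ k<n) | ∸-suc k<n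
  = refl

JSPoly : ℕ → ℤ → ℤ → ℤ
JSPoly zero    z = const 1ℤ
JSPoly (suc k) z = ∇⁻¹ (λ N → N * (N + z) * JSPoly k z N)

JSPoly-poly : ∀ k z → Polynomial (JSPoly k z)
JSPoly-poly zero    z = 1 , λ N → refl
JSPoly-poly (suc k) z with JSPoly-poly k z
... | d , p = 3 ℕ.+ d ,
  Poly<-∇⁻¹ (2 ℕ.+ d) _ (Poly<-cong (2 ℕ.+ d) (λ N → expand z N (P N))
    (Poly<-linear (2 ℕ.+ d) 1ℤ z (λ N → N * (N * P N)) (λ N → N * P N)
      (Poly<-* (suc d) (λ N → N * P N) (Poly<-* d P p))
      (Poly<-suc (suc d) (λ N → N * P N) (Poly<-* d P p))))
  where
  P = JSPoly k z
  expand : ∀ z N x → 1ℤ * (N * (N * x)) + z * (N * x) ≡ N * (N + z) * x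
  expand = solve-∀

F≡JSPoly : ∀ k z n → F k z n ≡ JSPoly k z (+ n)
F≡JSPoly zero    z n       = JS-diag n z
F≡JSPoly (suc k) z zero    = refl
F≡JSPoly (suc k) z (suc n) =
  cong₂ (λ x y → x + (+ suc n * (+ suc n + z)) * y)
    (trans (cong (λ j → JS j n z) (ℕₚ.+-suc k n)) (F≡JSPoly (suc k) z n))
    (F≡JSPoly k z (suc n))

pred-neg : ∀ n → pred (- + n) ≡ -[1+ n ]
pred-neg zero    = refl
pred-neg (suc n) = refl

G≡JSPoly : ∀ k z n → G k z n ≡ sgn k * JSPoly k (- z) (- + n)
G≡JSPoly zero    z n       = trans (G-≥ z {n} ℕ.z≤n) (js-diag n z)
G≡JSPoly (suc k) z zero    = trans (G-< {suc k} z {0} (s≤s ℕ.z≤n)) (sym (ℤₚ.*-zeroʳ (sgn (suc k))))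
G≡JSPoly (suc k) z (suc n) = begin
  G (suc k) z (suc n)                          ≡⟨ G-rec k z n ⟩
  G (suc k) z n + (+ n * (+ n + z)) * G k z n  ≡⟨ cong₂ (λ x y → x + (+ n * (+ n + z)) * y)
                                                        (G≡JSPoly (suc k) z n) (G≡JSPoly k z n) ⟩
  - s * P′ (- + n) + (+ n * (+ n + z)) * (s * P (- + n))
    ≡⟨ regroup s (P′ (- + n)) (P (- + n)) (+ n) z ⟩
  - s * (P′ (- + n) - (- + n) * (- + n + - z) * P (- + n))
    ≡⟨ cong ((- s) *_) (sym P′-step) ⟩
  - s * P′ -[1+ n ] ∎
  where
  s = sgn k
  P = JSPoly k (- z)
  P′ = JSPoly (suc k) (- z)
  regroup : ∀ s a b n z → - s * a + (n * (n + z)) * (s * b) ≡ - s * (a - (- n) * (- n + - z) * b)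
  regroup = solve-∀
  solve-for-subtrahend : ∀ x y → x - (x - y) ≡ y
  solve-for-subtrahend = solve-∀
  P′-step : P′ -[1+ n ] ≡ P′ (- + n) - (- + n) * (- + n + - z) * P (- + n)
  P′-step = begin
    P′ -[1+ n ]
      ≡⟨ sym (solve-for-subtrahend (P′ (- + n)) (P′ -[1+ n ])) ⟩
    P′ (- + n) - (P′ (- + n) - P′ -[1+ n ])
      ≡⟨ cong (λ N → P′ (- + n) - (P′ (- + n) - P′ N)) (sym (pred-neg n)) ⟩
    P′ (- + n) - ∇ P′ (- + n)
      ≡⟨ cong (_-_ (P′ (- + n))) (∇-∇⁻¹ _ (- + n)) ⟩
    P′ (- + n) - (- + n) * (- + n + - z) * P (- + n) ∎

lemma2p5 : (k : ℕ) → k ≥ 1 → (z : ℤ) → (m : ℕ) → (a : List ℤ)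
    → (∀ n → (F k (- z) ⊛ (oneMinusX ^ps m)) n ≡ poly a n)
    → ∀ n → (shift (length a) (G k z) ⊛ (xMinusOne ^ps m)) n
            ≡ (sgn (suc k) ·ps shift m (revPoly a)) n
lemma2p5 zero    ()
lemma2p5 (suc k) _ z m a numerator =
  reciprocity (JSPoly (suc k) (- z)) (F (suc k) (- z)) (G (suc k) z) (sgn (suc k)) m a
    (JSPoly-poly (suc k) (- z)) (F≡JSPoly (suc k) (- z)) (G-< {suc k} z {0} (s≤s ℕ.z≤n))
    (λ n → G≡JSPoly (suc k) z (suc n)) numerator
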